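{- Let $b,d$ be positive integers, let $T$ be any tree of order $n=b+d$ with vertex set $\{u_1,\ldots,u_b,v_1,\ldots,v_d\}$, and let $T_{b,d}$ be the tree obtained from $T$ as follows: (1) for every vertex $x$ of $T$, add two new vertices each adjacent only to $x$; (2) for every $i\in\{1,\ldots,b\}$, add a new copy of the star $K_{1,3}$ and join $u_i$ by an edge to one leaf of this star; (3) for every $i\in\{1,\ldots,d\}$, add a new copy of the tree obtained from $K_{1,3}$ by subdividing one edge once, and join $v_i$ by an edge to the leaf lying at the end of the subdivided edge. Then $T_{b,d}$ has order $3n+4b+5d$, has $2n+2b+2d$ leaves, $\beta(T_{b,d})=2n+3b+3d$ and $\gamma_{t,coi}(T_{b,d})=n+2b+2d$. Consequently $$\gamma_{t,coi}(T_{b,d})-\bigl(|V(T_{b,d})|-\beta(T_{b,d})\bigr)=b \quad\text{and}\quad \bigl(|V(T_{b,d})|-|L(T_{b,d})|\bigr)-\gamma_{t,coi}(T_{b,d})=d.$$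
   Context: All graphs are finite, simple and undirected. For a graph $G$, a set $D\subseteq V(G)$ is a total dominating set if every vertex of $G$ has at least one neighbor in $D$. A total dominating set $D$ is a total co-independent dominating set if $V(G)\setminus D$ is nonempty and independent. $\gamma_{t,coi}(G)$ is the minimum cardinality of a total co-independent dominating set of $G$. $\beta(G)$ is the maximum cardinality of an independent set of $G$. $L(G)$ is the set of leaves (vertices of degree one). -}

module Defs where

open import Data.Bool using (Bool; true; false; T; _∧_; _∨_)
open import Data.Nat using (ℕ; zero; suc; _+_; _*_; _≡ᵇ_; _≤_)
open import Data.Fin using (Fin; toℕ; splitAt; remQuot; _↑ˡ_; _↑ʳ_)
open import Data.Fin.Properties using (_≟_)
open import Data.Fin.Subset using (Subset; _∈_; _∉_; ∣_∣)
open import Data.Vec using (tabulate)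
open import Data.List using (List; []; _∷_; _++_; [_]; length)
open import Data.List.Relation.Unary.Linked using (Linked)
open import Data.List.Relation.Unary.Unique.Propositional using (Unique)
open import Data.Product using (Σ; ∃; _×_; _,_)
open import Data.Sum using (_⊎_; inj₁; inj₂)
open import Data.Empty using (⊥)
open import Relation.Nullary.Decidable using (⌊_⌋)
open import Relation.Binary.PropositionalEquality using (_≡_)

Graph : ℕ → Set
Graph N = Fin N → Fin N → Bool

Adj : ∀ {N} → Graph N → Fin N → Fin N → Set
Adj G x y = T (G x y)

IsSimple : ∀ {N} → Graph N → Set
IsSimple G = (∀ x y → G x y ≡ G y x) × (∀ x → ¬Adj x)
  where ¬Adj : _ → Set
        ¬Adj x = Adj G x x → ⊥

data Reach {N} (G : Graph N) : Fin N → Fin N → Set where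
  here : ∀ {x} → Reach G x x
  step : ∀ {x y z} → Adj G x y → Reach G y z → Reach G x z

Connected : ∀ {N} → Graph N → Set
Connected G = ∀ x y → Reach G x y

IsCycle : ∀ {N} → Graph N → List (Fin N) → Set
IsCycle G [] = ⊥
IsCycle G (x ∷ xs) =
  (3 ≤ length (x ∷ xs)) × Unique (x ∷ xs) × Linked (Adj G) ((x ∷ xs) ++ [ x ])

Acyclic : ∀ {N} → Graph N → Set
Acyclic G = ∀ cs → IsCycle G cs → ⊥

IsTree : ∀ {N} → Graph N → Set
IsTree G = IsSimple G × Connected G × Acyclic G

deg : ∀ {N} → Graph N → Fin N → ℕ
deg G v = ∣ tabulate (G v) ∣

leafCount : ∀ {N} → Graph N → ℕ
leafCount G = ∣ tabulate (λ v → deg G v ≡ᵇ 1) ∣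

Independent : ∀ {N} → Graph N → Subset N → Set
Independent G S = ∀ x y → x ∈ S → y ∈ S → Adj G x y → ⊥

IsIndependenceNumber : ∀ {N} → Graph N → ℕ → Set
IsIndependenceNumber G k =
  (Σ _ λ S → Independent G S × ∣ S ∣ ≡ k) ×
  (∀ S → Independent G S → ∣ S ∣ ≤ k)

TotalDominating : ∀ {N} → Graph N → Subset N → Set
TotalDominating G D = ∀ v → Σ _ λ u → u ∈ D × Adj G v u

TotalCoIndependentDominating : ∀ {N} → Graph N → Subset N → Set
TotalCoIndependentDominating G D =
  TotalDominating G D ×
  (Σ _ λ v → v ∉ D) ×
  (∀ x y → x ∉ D → y ∉ D → Adj G x y → ⊥)

IsTCoiNumber : ∀ {N} → Graph N → ℕ → Set
IsTCoiNumber G k =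
  (Σ _ λ D → TotalCoIndependentDominating G D × ∣ D ∣ ≡ k) ×
  (∀ D → TotalCoIndependentDominating G D → k ≤ ∣ D ∣)

-- The construction T_{b,d}.
-- T has vertex set Fin (b + d); u_i = i ↑ˡ d, v_i = b ↑ʳ i.

data Vtx (b d : ℕ) : Set where
  orig  : Fin (b + d) → Vtx b d
  pend  : Fin (b + d) → Fin 2 → Vtx b d    -- two new leaves at each x
  starU : Fin b → Fin 4 → Vtx b d          -- K_{1,3} for u_i: 0 = centre, 1,2,3 = leaves; leaf 1 joined to u_i
  spidV : Fin d → Fin 5 → Vtx b d          -- subdivided K_{1,3} for v_i: 0 centre, 1,2 leaves,
                                           -- 3 subdivision vertex, 4 end of subdivided edge (joined to v_i)

eqF : ∀ {n} → Fin n → Fin n → Bool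
eqF x y = ⌊ x ≟ y ⌋

starE : ℕ → ℕ → Bool
starE zero (suc _) = true
starE (suc _) zero = true
starE _ _ = false

spidE₀ : ℕ → ℕ → Bool
spidE₀ 0 1 = true
spidE₀ 0 2 = true
spidE₀ 0 3 = true
spidE₀ 3 4 = true
spidE₀ _ _ = false

spidE : ℕ → ℕ → Bool
spidE k l = spidE₀ k l ∨ spidE₀ l k

u : ∀ {b} d → Fin b → Fin (b + d)
u d i = i ↑ˡ d

v : ∀ b {d} → Fin d → Fin (b + d)
v b i = b ↑ʳ i

adjV : ∀ {b d} → Graph (b + d) → Vtx b d → Vtx b d → Bool
adjV T (orig x) (orig y) = T x y
adjV T (orig x) (pend y _) = eqF x y
adjV T (pend x _) (orig y) = eqF x y
adjV {b} {d} T (orig x) (starU i k) = eqF x (u d i) ∧ (toℕ k ≡ᵇ 1)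
adjV {b} {d} T (starU i k) (orig x) = eqF x (u d i) ∧ (toℕ k ≡ᵇ 1)
adjV {b} {d} T (orig x) (spidV i k) = eqF x (v b i) ∧ (toℕ k ≡ᵇ 4)
adjV {b} {d} T (spidV i k) (orig x) = eqF x (v b i) ∧ (toℕ k ≡ᵇ 4)
adjV T (starU i k) (starU j l) = eqF i j ∧ starE (toℕ k) (toℕ l)
adjV T (spidV i k) (spidV j l) = eqF i j ∧ spidE (toℕ k) (toℕ l)
adjV T _ _ = false

order : ℕ → ℕ → ℕ
order b d = (b + d) + ((b + d) * 2 + (b * 4 + d * 5))

-- enumeration of the vertices of T_{b,d} by Fin (order b d) (a bijection,
-- built from the stdlib bijections splitAt and remQuot)
decode : ∀ b d → Fin (order b d) → Vtx b d
decode b d x with splitAt (b + d) x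
... | inj₁ y = orig y
... | inj₂ r with splitAt ((b + d) * 2) r
...   | inj₁ p with remQuot 2 p
...     | (y , j) = pend y j
decode b d x | inj₂ r | inj₂ s with splitAt (b * 4) s
...     | inj₁ p with remQuot 4 p
...       | (i , k) = starU i k
decode b d x | inj₂ r | inj₂ s | inj₂ q with remQuot 5 q
...       | (i , k) = spidV i k

Tbd : ∀ b d → Graph (b + d) → Graph (order b d)
Tbd b d T x y = adjV T (decode b d x) (decode b d y)

module Submission where

-- T_{b,d} is built from gadgets joined only through the edges of T and one attaching
-- edge each: a hub K_{1,2} (an original vertex with its two pendant leaves) for every
-- vertex of T, a star K_{1,3} for every u_i and a spider (K_{1,3} with an edge
-- subdivided) for every v_i.  We first develop finite sums over Fin n and counts of
-- Boolean markings, bounded below by marked and above by unmarked points; then we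
-- identify Fin (order b d) with the vertices, so every cardinality is a gadget sum.
--   * Leaves: degree one means a unique neighbour; these are the pendant vertices and
--     two leaves of each star and spider, 2n + 2b + 2d in all.
--   * β: every edge meets `core` (original vertices, star centres, spider centres and
--     subdivision vertices), so its complement is independent; an independent set
--     misses an end of every edge, hence a vertex of each hub and star and two of each
--     spider, giving 2n + 3b + 3d.
--   * γ_{t,coi}: core plus the attaching leaf of each star dominates totally with
--     independent complement; any total dominating set must contain every original
--     vertex and each star or spider centre with one of its neighbours: n + 2b + 2d.
-- Both parameters being unique, the integer identities are arithmetic.

open import Defs
open import Data.Bool using (Bool; true; false; T; not; _∧_; _∨_)
open import Data.Bool.Properties using (T-∧; T-∨; T-≡; ∨-zeroʳ)
open import Data.Unit using (tt)
open import Data.Empty using (⊥; ⊥-elim)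
open import Data.Nat using (ℕ; zero; suc; _+_; _*_; _∸_; _≡ᵇ_; _≤_; z≤n; s≤s)
open import Data.Nat.Properties
  using (+-0-commutativeMonoid; +-assoc; +-identityʳ; +-mono-≤; +-monoʳ-≤; m≤m+n; *-identityʳ;
         m+n≤o⇒m≤o∸n; m+n∸m≡n; ≤-antisym; ≡ᵇ⇒≡)
open import Data.Nat.Tactic.RingSolver using (solve-∀)
open import Data.Integer using (+_; _-_)
open import Data.Integer.Properties using (m-n≡m⊖n; ⊖-≥)
open import Data.Fin using (Fin; toℕ; zero; suc; combine; splitAt; remQuot; punchIn; punchOut; _↑ˡ_; _↑ʳ_)
open import Data.Fin.Properties
  using (_≟_; all?; punchInᵢ≢i; punchIn-punchOut; splitAt-↑ˡ; splitAt-↑ʳ; splitAt⁻¹-↑ˡ;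
         splitAt⁻¹-↑ʳ; remQuot-combine; combine-remQuot)
open import Data.Fin.Patterns using (0F; 1F; 2F; 3F; 4F)
open import Data.Fin.Subset using (Subset; _∈_; _∉_; ∣_∣)
open import Data.Vec using ([]; _∷_; tabulate; lookup)
open import Data.Vec.Properties using (lookup∘tabulate; []=⇒lookup; lookup⇒[]=)
open import Data.Vec.Functional using (removeAt)
open import Data.Product using (Σ; _×_; _,_; proj₁; proj₂; uncurry)
open import Data.Sum using (_⊎_; inj₁; inj₂; [_,_]′) renaming (map to ⊎-map)
open import Function using (_∘_; Equivalence)
open import Relation.Nullary using (¬_; Dec; yes; no)
open import Relation.Nullary.Decidable using (True; T?; toWitness; fromWitness; _→-dec_)
open import Relation.Binary.PropositionalEquality
  using (_≡_; _≢_; refl; sym; trans; cong; cong₂; subst; subst₂; module ≡-Reasoning)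
open import Algebra.Properties.CommutativeMonoid.Sum +-0-commutativeMonoid
  using (sum; sum-syntax; sum-cong-≗; ∑-distrib-+; sum-remove; sum-replicate-zero)

open Equivalence using (to; from)

bit : Bool → ℕ
bit true  = 1
bit false = 0

bit-T : ∀ {x} → T x → bit x ≡ 1
bit-T {true} _ = refl

bit-¬T : ∀ {x} → ¬ T x → bit x ≡ 0
bit-¬T {true}  ¬x = ⊥-elim (¬x tt)
bit-¬T {false} _  = refl

T-not : ∀ {x} → ¬ T x → T (not x)
T-not {true}  ¬x = ¬x tt
T-not {false} _  = tt

not-T : ∀ {x} → T (not x) → ¬ T x
not-T {true} ()

T-∨-true : ∀ x → T (x ∨ true)
T-∨-true x = subst T (sym (∨-zeroʳ x)) tt

¬-both : ∀ x {y} → (T x → T y → ⊥) → ¬ T x ⊎ ¬ T y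
¬-both true  both = inj₂ (both tt)
¬-both false _    = inj₁ λ ()

count : ∀ {n} → (Fin n → Bool) → ℕ
count {n} a = ∑[ i < n ] bit (a i)

sum-const : ∀ n c → ∑[ i < n ] c ≡ n * c
sum-const zero    c = refl
sum-const (suc n) c = cong (_+_ c) (sum-const n c)

sum-mono : ∀ {n} {f g : Fin n → ℕ} → (∀ i → f i ≤ g i) → sum f ≤ sum g
sum-mono {zero}  _   = z≤n
sum-mono {suc n} f≤g = +-mono-≤ (f≤g zero) (sum-mono (f≤g ∘ suc))

sum-↑ : ∀ m n (f : Fin (m + n) → ℕ) → sum f ≡ ∑[ i < m ] f (i ↑ˡ n) + ∑[ j < n ] f (m ↑ʳ j)
sum-↑ zero    n f = refl
sum-↑ (suc m) n f = trans (cong (_+_ (f zero)) (sum-↑ m n (f ∘ suc))) (sym (+-assoc (f zero) _ _))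

sum-combine : ∀ m k (f : Fin (m * k) → ℕ) → sum f ≡ ∑[ i < m ] ∑[ j < k ] f (combine i j)
sum-combine zero    k f = refl
sum-combine (suc m) k f =
  trans (sum-↑ k (m * k) f) (cong (_+_ (∑[ j < k ] f (j ↑ˡ (m * k)))) (sum-combine m k (f ∘ (k ↑ʳ_))))

sum-pick : ∀ {n} (f : Fin n → ℕ) i → f i ≤ sum f
sum-pick {suc n} f i = subst (f i ≤_) (sym (sum-remove {i = i} f)) (m≤m+n (f i) _)

sum-pick₂ : ∀ {n} (f : Fin n → ℕ) {i j} → i ≢ j → f i + f j ≤ sum f
sum-pick₂ {suc n} f {i} {j} i≢j = begin
  f i + f j                         ≡⟨ cong (λ k → f i + f k) (sym (punchIn-punchOut i≢j)) ⟩
  f i + removeAt f i (punchOut i≢j) ≤⟨ +-monoʳ-≤ (f i) (sum-pick (removeAt f i) (punchOut i≢j)) ⟩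
  f i + sum (removeAt f i)          ≡⟨ sym (sum-remove f) ⟩
  sum f                             ∎
  where open Data.Nat.Properties.≤-Reasoning

sum-single : ∀ {n} (f : Fin n → ℕ) i → (∀ j → j ≢ i → f j ≡ 0) → sum f ≡ f i
sum-single {suc n} f i vanish = begin
  sum f                    ≡⟨ sum-remove f ⟩
  f i + sum (removeAt f i) ≡⟨ cong (_+_ (f i)) (sum-cong-≗ λ j → vanish (punchIn i j) (punchInᵢ≢i i j)) ⟩
  f i + ∑[ j < n ] 0       ≡⟨ cong (_+_ (f i)) (sum-replicate-zero n) ⟩
  f i + 0                  ≡⟨ +-identityʳ (f i) ⟩
  f i                      ∎
  where open ≡-Reasoning

count-split : ∀ {n} (a : Fin n → Bool) → count a + count (not ∘ a) ≡ n
count-split {n} a = begin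
  count a + count (not ∘ a)                 ≡⟨ sym (∑-distrib-+ (bit ∘ a) (bit ∘ not ∘ a)) ⟩
  ∑[ i < n ] (bit (a i) + bit (not (a i))) ≡⟨ sum-cong-≗ (λ i → bit+bit-not (a i)) ⟩
  ∑[ i < n ] 1                              ≡⟨ sum-const n 1 ⟩
  n * 1                                     ≡⟨ *-identityʳ n ⟩
  n                                         ∎
  where
    open ≡-Reasoning
    bit+bit-not : ∀ x → bit x + bit (not x) ≡ 1
    bit+bit-not true  = refl
    bit+bit-not false = refl

marked : ∀ {n} (a : Fin n → Bool) {i} → T (a i) → 1 ≤ count a
marked a {i} ai = subst (_≤ count a) (bit-T ai) (sum-pick (bit ∘ a) i)

marked₂ : ∀ {n} (a : Fin n → Bool) {i j} → i ≢ j → T (a i) → T (a j) → 2 ≤ count a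
marked₂ a i≢j ai aj = subst (_≤ count a) (cong₂ _+_ (bit-T ai) (bit-T aj)) (sum-pick₂ (bit ∘ a) i≢j)

unmarked-bound : ∀ {n} (a : Fin n → Bool) {m} → m ≤ count (not ∘ a) → count a ≤ n ∸ m
unmarked-bound a {m} m≤ =
  m+n≤o⇒m≤o∸n (count a) (subst (count a + m ≤_) (count-split a) (+-monoʳ-≤ (count a) m≤))

unmarked : ∀ {n} (a : Fin n → Bool) {i} → ¬ T (a i) → count a ≤ n ∸ 1
unmarked a ¬ai = unmarked-bound a (marked (not ∘ a) (T-not ¬ai))

unmarked₂ : ∀ {n} (a : Fin n → Bool) {i j} → i ≢ j → ¬ T (a i) → ¬ T (a j) → count a ≤ n ∸ 2
unmarked₂ a i≢j ¬ai ¬aj = unmarked-bound a (marked₂ (not ∘ a) i≢j (T-not ¬ai) (T-not ¬aj))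

∣∣-count : ∀ {n} (p : Subset n) → ∣ p ∣ ≡ count (lookup p)
∣∣-count []          = refl
∣∣-count (true ∷ p)  = cong suc (∣∣-count p)
∣∣-count (false ∷ p) = ∣∣-count p

∣tabulate∣ : ∀ {n} (f : Fin n → Bool) → ∣ tabulate f ∣ ≡ count f
∣tabulate∣ f = trans (∣∣-count (tabulate f)) (sum-cong-≗ (cong bit ∘ lookup∘tabulate f))

∈⇒T : ∀ {n} {p : Subset n} {x} → x ∈ p → T (lookup p x)
∈⇒T x∈p = from T-≡ ([]=⇒lookup x∈p)

T⇒∈ : ∀ {n} {p : Subset n} {x} → T (lookup p x) → x ∈ p
T⇒∈ {p = p} {x} t = lookup⇒[]= x p (to T-≡ t)

∈-tabulate : ∀ {n} {f : Fin n → Bool} {x} → x ∈ tabulate f → T (f x)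
∈-tabulate {f = f} {x} x∈ = subst T (lookup∘tabulate f x) (∈⇒T x∈)

tabulate-∈ : ∀ {n} {f : Fin n → Bool} {x} → T (f x) → x ∈ tabulate f
tabulate-∈ {f = f} {x} fx = T⇒∈ (subst T (sym (lookup∘tabulate f x)) fx)

module _ {N} (G : Graph N) where

  deg-one : ∀ {y z} → Adj G y z → (∀ z' → Adj G y z' → z' ≡ z) → deg G y ≡ 1
  deg-one {y} {z} yz unique =
    trans (∣tabulate∣ (G y))
          (trans (sum-single (bit ∘ G y) z (λ j j≢z → bit-¬T (j≢z ∘ unique j))) (bit-T yz))

  deg-two : ∀ {y z z'} → z ≢ z' → Adj G y z → Adj G y z' → 2 ≤ deg G y
  deg-two {y} z≢z' yz yz' = subst (2 ≤_) (sym (∣tabulate∣ (G y))) (marked₂ (G y) z≢z' yz yz')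

  reach⇒neighbour : ∀ {x z} → Reach G x z → x ≢ z → Σ (Fin N) (Adj G x)
  reach⇒neighbour here         x≢z = ⊥-elim (x≢z refl)
  reach⇒neighbour (step xw _)  _   = _ , xw

  connected⇒neighbour : Connected G → ∀ {y z} → y ≢ z → ∀ x → Σ (Fin N) (Adj G x)
  connected⇒neighbour connected {y} {z} y≢z x with x ≟ y
  ... | yes refl = reach⇒neighbour (connected x z) y≢z
  ... | no x≢y   = reach⇒neighbour (connected x y) x≢y

  independence-number-unique : ∀ {k k'} → IsIndependenceNumber G k → IsIndependenceNumber G k' → k ≡ k'
  independence-number-unique ((S , indS , ∣S∣≡k) , maxk) ((S' , indS' , ∣S'∣≡k') , maxk') =
    ≤-antisym (subst (_≤ _) ∣S∣≡k (maxk' S indS)) (subst (_≤ _) ∣S'∣≡k' (maxk S' indS'))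

  tcoi-number-unique : ∀ {k k'} → IsTCoiNumber G k → IsTCoiNumber G k' → k ≡ k'
  tcoi-number-unique ((D , tcD , ∣D∣≡k) , mink) ((D' , tcD' , ∣D'∣≡k') , mink') =
    ≤-antisym (subst (_ ≤_) ∣D'∣≡k' (mink D' tcD')) (subst (_ ≤_) ∣D∣≡k (mink' D tcD))

module Vertices (b d : ℕ) where

  n : ℕ
  n = b + d

  enc : Vtx b d → Fin (order b d)
  enc (orig x)    = x ↑ˡ (n * 2 + (b * 4 + d * 5))
  enc (pend x j)  = n ↑ʳ (combine x j ↑ˡ (b * 4 + d * 5))
  enc (starU i k) = n ↑ʳ ((n * 2) ↑ʳ (combine i k ↑ˡ (d * 5)))
  enc (spidV i k) = n ↑ʳ ((n * 2) ↑ʳ ((b * 4) ↑ʳ combine i k))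

  dec-enc : ∀ w → decode b d (enc w) ≡ w
  dec-enc (orig x) rewrite splitAt-↑ˡ n x (n * 2 + (b * 4 + d * 5)) = refl
  dec-enc (pend x j)
    rewrite splitAt-↑ʳ n (n * 2 + (b * 4 + d * 5)) (combine x j ↑ˡ (b * 4 + d * 5))
          | splitAt-↑ˡ (n * 2) (combine x j) (b * 4 + d * 5)
          = cong (λ (x , j) → pend x j) (remQuot-combine x j)
  dec-enc (starU i k)
    rewrite splitAt-↑ʳ n (n * 2 + (b * 4 + d * 5)) ((n * 2) ↑ʳ (combine i k ↑ˡ (d * 5)))
          | splitAt-↑ʳ (n * 2) (b * 4 + d * 5) (combine i k ↑ˡ (d * 5))
          | splitAt-↑ˡ (b * 4) (combine i k) (d * 5)
          = cong (λ (i , k) → starU i k) (remQuot-combine i k)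
  dec-enc (spidV i k)
    rewrite splitAt-↑ʳ n (n * 2 + (b * 4 + d * 5)) ((n * 2) ↑ʳ ((b * 4) ↑ʳ combine i k))
          | splitAt-↑ʳ (n * 2) (b * 4 + d * 5) ((b * 4) ↑ʳ combine i k)
          | splitAt-↑ʳ (b * 4) (d * 5) (combine i k)
          = cong (λ (i , k) → spidV i k) (remQuot-combine i k)

  enc-dec : ∀ y → enc (decode b d y) ≡ y
  enc-dec y with splitAt n y in y≡
  ... | inj₁ x = splitAt⁻¹-↑ˡ y≡
  ... | inj₂ r with splitAt (n * 2) r in r≡
  ...   | inj₁ p = begin
    n ↑ʳ (uncurry combine (remQuot {n} 2 p) ↑ˡ (b * 4 + d * 5)) ≡⟨ cong (λ q → n ↑ʳ (q ↑ˡ (b * 4 + d * 5))) (combine-remQuot {n} 2 p) ⟩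
    n ↑ʳ (p ↑ˡ (b * 4 + d * 5))           ≡⟨ cong (n ↑ʳ_) (splitAt⁻¹-↑ˡ r≡) ⟩
    n ↑ʳ r                                ≡⟨ splitAt⁻¹-↑ʳ y≡ ⟩
    y                                     ∎
    where open ≡-Reasoning
  enc-dec y | inj₂ r | inj₂ s with splitAt (b * 4) s in s≡
  ...     | inj₁ p = begin
    n ↑ʳ ((n * 2) ↑ʳ (uncurry combine (remQuot {b} 4 p) ↑ˡ (d * 5))) ≡⟨ cong (λ q → n ↑ʳ ((n * 2) ↑ʳ (q ↑ˡ (d * 5)))) (combine-remQuot {b} 4 p) ⟩
    n ↑ʳ ((n * 2) ↑ʳ (p ↑ˡ (d * 5)))           ≡⟨ cong (λ q → n ↑ʳ ((n * 2) ↑ʳ q)) (splitAt⁻¹-↑ˡ s≡) ⟩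
    n ↑ʳ ((n * 2) ↑ʳ s)                        ≡⟨ cong (n ↑ʳ_) (splitAt⁻¹-↑ʳ r≡) ⟩
    n ↑ʳ r                                     ≡⟨ splitAt⁻¹-↑ʳ y≡ ⟩
    y                                          ∎
    where open ≡-Reasoning
  ...     | inj₂ q = begin
    n ↑ʳ ((n * 2) ↑ʳ ((b * 4) ↑ʳ uncurry combine (remQuot {d} 5 q))) ≡⟨ cong (λ t → n ↑ʳ ((n * 2) ↑ʳ ((b * 4) ↑ʳ t))) (combine-remQuot {d} 5 q) ⟩
    n ↑ʳ ((n * 2) ↑ʳ ((b * 4) ↑ʳ q))           ≡⟨ cong (λ t → n ↑ʳ ((n * 2) ↑ʳ t)) (splitAt⁻¹-↑ʳ s≡) ⟩
    n ↑ʳ ((n * 2) ↑ʳ s)                        ≡⟨ cong (n ↑ʳ_) (splitAt⁻¹-↑ʳ r≡) ⟩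
    n ↑ʳ r                                     ≡⟨ splitAt⁻¹-↑ʳ y≡ ⟩
    y                                          ∎
    where open ≡-Reasoning

  enc-injective : ∀ {w w'} → enc w ≡ enc w' → w ≡ w'
  enc-injective {w} {w'} e = trans (sym (dec-enc w)) (trans (cong (decode b d) e) (dec-enc w'))

  hub : Fin n → Fin 3 → Vtx b d
  hub x zero    = orig x
  hub x (suc j) = pend x j

  ∑V : (Vtx b d → ℕ) → ℕ
  ∑V g = ∑[ x < n ] ∑[ k < 3 ] g (hub x k)
       + (∑[ i < b ] ∑[ k < 4 ] g (starU i k) + ∑[ i < d ] ∑[ k < 5 ] g (spidV i k))

  sum-vertices : (f : Fin (order b d) → ℕ) → sum f ≡ ∑V (f ∘ enc)
  sum-vertices f = begin
    sum f
      ≡⟨ sum-↑ n _ f ⟩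
    ∑[ x < n ] f (enc (orig x)) + sum (f ∘ (n ↑ʳ_))
      ≡⟨ cong (_+_ (∑[ x < n ] f (enc (orig x)))) blocks ⟩
    ∑[ x < n ] f (enc (orig x)) + (∑[ x < n ] ∑[ j < 2 ] f (enc (pend x j)) + gadgets)
      ≡⟨ sym (+-assoc (∑[ x < n ] f (enc (orig x))) (∑[ x < n ] ∑[ j < 2 ] f (enc (pend x j))) gadgets) ⟩
    ∑[ x < n ] f (enc (orig x)) + ∑[ x < n ] ∑[ j < 2 ] f (enc (pend x j)) + gadgets
      ≡⟨ cong (_+ gadgets) (sym (∑-distrib-+ (λ x → f (enc (orig x))) (λ x → ∑[ j < 2 ] f (enc (pend x j))))) ⟩
    ∑V (f ∘ enc) ∎
    where
      open ≡-Reasoning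
      gadgets : ℕ
      gadgets = ∑[ i < b ] ∑[ k < 4 ] f (enc (starU i k)) + ∑[ i < d ] ∑[ k < 5 ] f (enc (spidV i k))
      blocks : sum (f ∘ (n ↑ʳ_)) ≡ ∑[ x < n ] ∑[ j < 2 ] f (enc (pend x j)) + gadgets
      blocks = trans (sum-↑ (n * 2) _ _)
        (cong₂ _+_ (sum-combine n 2 _)
          (trans (sum-↑ (b * 4) (d * 5) _) (cong₂ _+_ (sum-combine b 4 _) (sum-combine d 5 _))))

  ∑V-cong : ∀ {g h : Vtx b d → ℕ} → (∀ w → g w ≡ h w) → ∑V g ≡ ∑V h
  ∑V-cong g≡h = cong₂ _+_ (sum-cong-≗ λ x → sum-cong-≗ λ k → g≡h (hub x k))
    (cong₂ _+_ (sum-cong-≗ λ i → sum-cong-≗ λ k → g≡h (starU i k))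
               (sum-cong-≗ λ i → sum-cong-≗ λ k → g≡h (spidV i k)))

  ∣tabulate-decode∣ : (m : Vtx b d → Bool) → ∣ tabulate (m ∘ decode b d) ∣ ≡ ∑V (bit ∘ m)
  ∣tabulate-decode∣ m = trans (∣tabulate∣ (m ∘ decode b d))
    (trans (sum-vertices (bit ∘ m ∘ decode b d)) (∑V-cong (cong (bit ∘ m) ∘ dec-enc)))

  ∑V-≤ : ∀ (g : Vtx b d → ℕ) {A B C} →
         (∀ x → ∑[ k < 3 ] g (hub x k) ≤ A) → (∀ i → ∑[ k < 4 ] g (starU i k) ≤ B) →
         (∀ i → ∑[ k < 5 ] g (spidV i k) ≤ C) → ∑V g ≤ n * A + (b * B + d * C)
  ∑V-≤ g {A} {B} {C} hubs stars spiders =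
    +-mono-≤ (bounded hubs) (+-mono-≤ (bounded stars) (bounded spiders))
    where bounded : ∀ {m c} {f : Fin m → ℕ} → (∀ i → f i ≤ c) → sum f ≤ m * c
          bounded {m} {c} f≤c = subst (_ ≤_) (sum-const m c) (sum-mono f≤c)

  ∑V-≥ : ∀ (g : Vtx b d → ℕ) {A B C} →
         (∀ x → A ≤ ∑[ k < 3 ] g (hub x k)) → (∀ i → B ≤ ∑[ k < 4 ] g (starU i k)) →
         (∀ i → C ≤ ∑[ k < 5 ] g (spidV i k)) → n * A + (b * B + d * C) ≤ ∑V g
  ∑V-≥ g {A} {B} {C} hubs stars spiders =
    +-mono-≤ (bounded hubs) (+-mono-≤ (bounded stars) (bounded spiders))
    where bounded : ∀ {m c} {f : Fin m → ℕ} → (∀ i → c ≤ f i) → m * c ≤ sum f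
          bounded {m} {c} c≤f = subst (_≤ _) (sum-const m c) (sum-mono c≤f)

  uniform : (Fin 3 → Bool) → (Fin 4 → Bool) → (Fin 5 → Bool) → Vtx b d → Bool
  uniform p q r (orig x)    = p zero
  uniform p q r (pend x j)  = p (suc j)
  uniform p q r (starU i k) = q k
  uniform p q r (spidV i k) = r k

  ∑V-uniform : ∀ p q r → ∑V (bit ∘ uniform p q r) ≡ n * count p + (b * count q + d * count r)
  ∑V-uniform p q r = cong₂ _+_ (sum-const n _) (cong₂ _+_ (sum-const b _) (sum-const d _))

by-evaluation : ∀ {m n} {P : Fin m → Fin n → Set} (P? : ∀ k l → Dec (P k l)) →
                {True (all? λ k → all? (P? k))} → ∀ k l → P k l
by-evaluation P? {checked} = toWitness checked

centre-≢ : ∀ (E : ℕ → ℕ → Bool) {m} {l : Fin (suc m)} → ¬ T (E 0 0) → T (E 0 (toℕ l)) → zero ≢ l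
centre-≢ E ¬loop e refl = ¬loop e

star-leaf-nb : ∀ k (l : Fin 4) → T (starE (suc k) (toℕ l)) → l ≡ zero
star-leaf-nb k zero    _ = refl
star-leaf-nb k (suc l) ()

centre : ∀ {m} → Fin m → Bool
centre zero    = true
centre (suc _) = false

starLeaf : Fin 4 → Bool
starLeaf zero          = false
starLeaf (suc zero)    = false
starLeaf (suc (suc _)) = true

spiderLeaf : Fin 5 → Bool
spiderLeaf k = (toℕ k ≡ᵇ 1) ∨ (toℕ k ≡ᵇ 2)

spider-leaf-nb : ∀ (k l : Fin 5) → T (spiderLeaf k) → T (spidE (toℕ k) (toℕ l)) → l ≡ zero
spider-leaf-nb = by-evaluation λ k l → T? (spiderLeaf k) →-dec (T? (spidE (toℕ k) (toℕ l)) →-dec (l ≟ zero))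

spiderCore : Fin 5 → Bool
spiderCore k = (toℕ k ≡ᵇ 0) ∨ (toℕ k ≡ᵇ 3)

star-cover : ∀ (k l : Fin 4) → T (starE (toℕ k) (toℕ l)) → T (centre k ∨ centre l)
star-cover zero    _       _ = tt
star-cover (suc _) zero    _ = tt
star-cover (suc _) (suc _) ()

spider-cover : ∀ k l → T (spidE (toℕ k) (toℕ l)) → T (spiderCore k ∨ spiderCore l)
spider-cover = by-evaluation λ k l → T? (spidE (toℕ k) (toℕ l)) →-dec T? (spiderCore k ∨ spiderCore l)

module Construction (b d : ℕ) (Tr : Graph (b + d)) where

  open Vertices b d public

  G : Graph (order b d)
  G = Tbd b d Tr

  _~_ : Vtx b d → Vtx b d → Set
  w ~ w' = T (adjV Tr w w')

  ~⇒Adj : ∀ w w' → w ~ w' → Adj G (enc w) (enc w')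
  ~⇒Adj w w' = subst₂ _~_ (sym (dec-enc w)) (sym (dec-enc w'))

  Adj⇒~ : ∀ w z → Adj G (enc w) z → w ~ decode b d z
  Adj⇒~ w z = subst (_~ decode b d z) (dec-enc w)

  in-copy : ∀ {m} {i : Fin m} {c} → T c → T (eqF i i ∧ c)
  in-copy c = from T-∧ (fromWitness refl , c)

  same-copy : ∀ {m} {i j : Fin m} {c} → T (eqF i j ∧ c) → i ≡ j × T c
  same-copy {i = i} {j} {c} e with to (T-∧ {eqF i j} {c}) e
  ... | i≟j , holds = toWitness i≟j , holds

  hang-edge : ∀ x j → orig x ~ pend x j
  hang-edge x j = fromWitness refl

  pend-edge : ∀ x j → pend x j ~ orig x
  pend-edge x j = fromWitness refl

  star-edge : ∀ {i} k l → T (starE (toℕ k) (toℕ l)) → starU i k ~ starU i l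
  star-edge k l = in-copy

  spider-edge : ∀ {i} k l → T (spidE (toℕ k) (toℕ l)) → spidV i k ~ spidV i l
  spider-edge k l = in-copy

  star-attach : ∀ i → starU i 1F ~ orig (u d i)
  star-attach i = in-copy tt

  spider-attach : ∀ i → spidV i 4F ~ orig (v b i)
  spider-attach i = in-copy tt

  pend-nb : ∀ {x j w} → pend x j ~ w → w ≡ orig x
  pend-nb {x} {w = orig y} e = cong orig (sym (toWitness e))

  star-nb : ∀ {i k w} → toℕ k ≢ 1 → starU i k ~ w →
            Σ (Fin 4) λ l → w ≡ starU i l × T (starE (toℕ k) (toℕ l))
  star-nb {i} {k} {orig y} k≢1 e = ⊥-elim (k≢1 (≡ᵇ⇒≡ (toℕ k) 1 (proj₂ (same-copy {i = y} {u d i} e))))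
  star-nb {i} {w = starU j l} _ e with same-copy {i = i} {j} e
  ... | refl , kl = l , refl , kl

  spider-nb : ∀ {i k w} → toℕ k ≢ 4 → spidV i k ~ w →
              Σ (Fin 5) λ l → w ≡ spidV i l × T (spidE (toℕ k) (toℕ l))
  spider-nb {i} {k} {orig y} k≢4 e = ⊥-elim (k≢4 (≡ᵇ⇒≡ (toℕ k) 4 (proj₂ (same-copy {i = y} {v b i} e))))
  spider-nb {i} {w = spidV j l} _ e with same-copy {i = i} {j} e
  ... | refl , kl = l , refl , kl

  star-leaf-centre : ∀ {i w'} k → starU i (suc (suc k)) ~ w' → w' ≡ starU i 0F
  star-leaf-centre {i} {w'} k e with star-nb {i} {suc (suc k)} {w'} (λ ()) e
  ... | l , refl , kl = cong (starU i) (star-leaf-nb (suc (toℕ k)) l kl)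

  spider-leaf-centre : ∀ {i w'} k → toℕ k ≢ 4 → T (spiderLeaf k) → spidV i k ~ w' → w' ≡ spidV i 0F
  spider-leaf-centre {i} {w'} k k≢4 leaf-k e with spider-nb {i} {k} {w'} k≢4 e
  ... | l , refl , kl = cong (spidV i) (spider-leaf-nb k l leaf-k kl)

  leaf-vertex : ∀ w w₀ → w ~ w₀ → (∀ {w'} → w ~ w' → w' ≡ w₀) → (deg G (enc w) ≡ᵇ 1) ≡ true
  leaf-vertex w w₀ e unique =
    cong (_≡ᵇ 1) (deg-one G (~⇒Adj w w₀ e) λ z a → trans (sym (enc-dec z)) (cong enc (unique (Adj⇒~ w z a))))

  branch-vertex : ∀ w w₁ w₂ → w₁ ≢ w₂ → w ~ w₁ → w ~ w₂ → (deg G (enc w) ≡ᵇ 1) ≡ false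
  branch-vertex w w₁ w₂ w₁≢w₂ e₁ e₂ =
    ≥2⇒≢1 (deg-two G (w₁≢w₂ ∘ enc-injective) (~⇒Adj w w₁ e₁) (~⇒Adj w w₂ e₂))
    where ≥2⇒≢1 : ∀ {m} → 2 ≤ m → (m ≡ᵇ 1) ≡ false
          ≥2⇒≢1 (s≤s (s≤s _)) = refl

  leaf : Vtx b d → Bool
  leaf = uniform (not ∘ centre) starLeaf spiderLeaf

  is-leaf : ∀ w → (deg G (enc w) ≡ᵇ 1) ≡ leaf w
  is-leaf w@(orig x) =
    branch-vertex w (pend x 0F) (pend x 1F) (λ ()) (hang-edge x 0F) (hang-edge x 1F)
  is-leaf w@(pend x j) = leaf-vertex w (orig x) (pend-edge x j) pend-nb
  is-leaf w@(starU i zero) =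
    branch-vertex w (starU i 1F) (starU i 2F) (λ ()) (star-edge 0F 1F tt) (star-edge 0F 2F tt)
  is-leaf w@(starU i (suc zero)) =
    branch-vertex w (starU i 0F) (orig (u d i)) (λ ()) (star-edge 1F 0F tt) (star-attach i)
  is-leaf w@(starU i (suc (suc k))) =
    leaf-vertex w (starU i 0F) (star-edge (suc (suc k)) 0F tt) (star-leaf-centre k)
  is-leaf w@(spidV i 0F) =
    branch-vertex w (spidV i 1F) (spidV i 2F) (λ ()) (spider-edge 0F 1F tt) (spider-edge 0F 2F tt)
  is-leaf w@(spidV i 1F) =
    leaf-vertex w (spidV i 0F) (spider-edge 1F 0F tt) (spider-leaf-centre 1F (λ ()) tt)
  is-leaf w@(spidV i 2F) =
    leaf-vertex w (spidV i 0F) (spider-edge 2F 0F tt) (spider-leaf-centre 2F (λ ()) tt)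
  is-leaf w@(spidV i 3F) =
    branch-vertex w (spidV i 0F) (spidV i 4F) (λ ()) (spider-edge 3F 0F tt) (spider-edge 3F 4F tt)
  is-leaf w@(spidV i 4F) =
    branch-vertex w (spidV i 3F) (orig (v b i)) (λ ()) (spider-edge 4F 3F tt) (spider-attach i)

  leafCount-Tbd : leafCount G ≡ n * 2 + (b * 2 + d * 2)
  leafCount-Tbd = begin
    leafCount G                          ≡⟨ ∣tabulate∣ (λ y → deg G y ≡ᵇ 1) ⟩
    count (λ y → deg G y ≡ᵇ 1)           ≡⟨ sum-vertices _ ⟩
    ∑V (λ w → bit (deg G (enc w) ≡ᵇ 1)) ≡⟨ ∑V-cong (cong bit ∘ is-leaf) ⟩
    ∑V (bit ∘ leaf)                      ≡⟨ ∑V-uniform (not ∘ centre) starLeaf spiderLeaf ⟩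
    n * 2 + (b * 2 + d * 2)              ∎
    where open ≡-Reasoning

  core : Vtx b d → Bool
  core = uniform centre centre spiderCore

  VertexCover : (Vtx b d → Bool) → Set
  VertexCover c = ∀ w w' → w ~ w' → T (c w ∨ c w')

  core-covers : VertexCover core
  core-covers (orig _)    _           _ = tt
  core-covers (pend _ _)  (orig _)    _ = tt
  core-covers (starU _ k) (orig _)    _ = T-∨-true (centre k)
  core-covers (spidV _ k) (orig _)    _ = T-∨-true (spiderCore k)
  core-covers (starU i k) (starU j l) e = star-cover k l (proj₂ (same-copy {i = i} {j} e))
  core-covers (spidV i k) (spidV j l) e = spider-cover k l (proj₂ (same-copy {i = i} {j} e))
  core-covers (pend _ _)  (pend _ _)  ()
  core-covers (pend _ _)  (starU _ _) ()
  core-covers (pend _ _)  (spidV _ _) ()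
  core-covers (starU _ _) (pend _ _)  ()
  core-covers (starU _ _) (spidV _ _) ()
  core-covers (spidV _ _) (pend _ _)  ()
  core-covers (spidV _ _) (starU _ _) ()

  cover-mono : ∀ {c c'} → (∀ w → T (c w) → T (c' w)) → VertexCover c → VertexCover c'
  cover-mono {c} {c'} c⊆c' cover w w' e =
    from T-∨ (⊎-map (c⊆c' w) (c⊆c' w') (to (T-∨ {c w} {c w'}) (cover w w' e)))

  outside-cover : ∀ c → VertexCover c → ∀ w w' → ¬ T (c w) → ¬ T (c w') → ¬ (w ~ w')
  outside-cover c cover w w' ¬cw ¬cw' e = [ ¬cw , ¬cw' ]′ (to (T-∨ {c w} {c w'}) (cover w w' e))

  indepSet : Subset (order b d)
  indepSet = tabulate (not ∘ core ∘ decode b d)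

  indepSet-independent : Independent G indepSet
  indepSet-independent y z y∈ z∈ =
    outside-cover core core-covers (decode b d y) (decode b d z) (not-T (∈-tabulate y∈)) (not-T (∈-tabulate z∈))

  indepSet-size : ∣ indepSet ∣ ≡ n * 2 + (b * 3 + d * 3)
  indepSet-size =
    trans (∣tabulate-decode∣ (not ∘ core)) (∑V-uniform (not ∘ centre) (not ∘ centre) (not ∘ spiderCore))

  -- An independent set misses an end of every edge: at least one vertex of each
  -- hub and each star, and two of each spider (edges 0-1 and 3-4).
  independent-bound : ∀ S → Independent G S → ∣ S ∣ ≤ n * 2 + (b * 3 + d * 3)
  independent-bound S indep = begin
    ∣ S ∣             ≡⟨ ∣∣-count S ⟩
    count (lookup S) ≡⟨ sum-vertices _ ⟩
    ∑V (bit ∘ inS)   ≤⟨ ∑V-≤ (bit ∘ inS) hub-bound star-bound spider-bound ⟩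
    n * 2 + (b * 3 + d * 3) ∎
    where
      open Data.Nat.Properties.≤-Reasoning
      inS : Vtx b d → Bool
      inS w = lookup S (enc w)

      misses : ∀ w w' → w ~ w' → ¬ T (inS w) ⊎ ¬ T (inS w')
      misses w w' e = ¬-both (inS w) λ w∈ w'∈ → indep (enc w) (enc w') (T⇒∈ w∈) (T⇒∈ w'∈) (~⇒Adj w w' e)

      hub-bound : ∀ x → count (inS ∘ hub x) ≤ 2
      hub-bound x = [ unmarked (inS ∘ hub x) {0F} , unmarked (inS ∘ hub x) {1F} ]′
                      (misses (orig x) (pend x 0F) (hang-edge x 0F))

      star-bound : ∀ i → count (inS ∘ starU i) ≤ 3
      star-bound i = [ unmarked (inS ∘ starU i) {0F} , unmarked (inS ∘ starU i) {1F} ]′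
                       (misses (starU i 0F) (starU i 1F) (star-edge 0F 1F tt))

      spider-bound : ∀ i → count (inS ∘ spidV i) ≤ 3
      spider-bound i with misses (spidV i 0F) (spidV i 1F) (spider-edge 0F 1F tt)
                        | misses (spidV i 3F) (spidV i 4F) (spider-edge 3F 4F tt)
      ... | inj₁ ¬0 | inj₁ ¬3 = unmarked₂ (inS ∘ spidV i) (λ ()) ¬0 ¬3
      ... | inj₁ ¬0 | inj₂ ¬4 = unmarked₂ (inS ∘ spidV i) (λ ()) ¬0 ¬4
      ... | inj₂ ¬1 | inj₁ ¬3 = unmarked₂ (inS ∘ spidV i) (λ ()) ¬1 ¬3
      ... | inj₂ ¬1 | inj₂ ¬4 = unmarked₂ (inS ∘ spidV i) (λ ()) ¬1 ¬4

  -- Adding the attaching leaf of every star to core gives a total dominating set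
  -- of size n + 2b + 2d whose complement is independent.
  domStar : Fin 4 → Bool
  domStar zero          = true
  domStar (suc zero)    = true
  domStar (suc (suc _)) = false

  dom : Vtx b d → Bool
  dom = uniform centre domStar spiderCore

  core⊆dom : ∀ w → T (core w) → T (dom w)
  core⊆dom (orig _)          c = c
  core⊆dom (starU _ zero)    c = c
  core⊆dom (starU _ (suc _)) ()
  core⊆dom (spidV _ _)       c = c

  dom-dominates : (∀ x → Σ (Fin (b + d)) (Adj Tr x)) → ∀ w → Σ (Vtx b d) λ w' → T (dom w') × w ~ w'
  dom-dominates nb (orig x)          = orig (proj₁ (nb x)) , tt , proj₂ (nb x)
  dom-dominates nb (pend x j)        = orig x , tt , pend-edge x j
  dom-dominates nb (starU i zero)    = starU i 1F , tt , star-edge 0F 1F tt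
  dom-dominates nb (starU i (suc k)) = starU i 0F , tt , star-edge (suc k) 0F tt
  dom-dominates nb (spidV i 0F)      = spidV i 3F , tt , spider-edge 0F 3F tt
  dom-dominates nb (spidV i 1F)      = spidV i 0F , tt , spider-edge 1F 0F tt
  dom-dominates nb (spidV i 2F)      = spidV i 0F , tt , spider-edge 2F 0F tt
  dom-dominates nb (spidV i 3F)      = spidV i 0F , tt , spider-edge 3F 0F tt
  dom-dominates nb (spidV i 4F)      = spidV i 3F , tt , spider-edge 4F 3F tt

  domSet : Subset (order b d)
  domSet = tabulate (dom ∘ decode b d)

  domSet-tcoi : (∀ x → Σ (Fin (b + d)) (Adj Tr x)) → Fin (b + d) → TotalCoIndependentDominating G domSet
  domSet-tcoi nb x₀ = dominating , (enc (pend x₀ 0F) , outside) , co-independent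
    where
      ∉domSet : ∀ {y} → y ∉ domSet → ¬ T (dom (decode b d y))
      ∉domSet y∉ = y∉ ∘ tabulate-∈

      dominating : TotalDominating G domSet
      dominating y with dom-dominates nb (decode b d y)
      ... | w' , dom-w' , e = enc w' , tabulate-∈ (subst (T ∘ dom) (sym (dec-enc w')) dom-w')
                                     , subst (decode b d y ~_) (sym (dec-enc w')) e

      outside : enc (pend x₀ 0F) ∉ domSet
      outside = subst (λ w → ¬ T (dom w)) (sym (dec-enc (pend x₀ 0F))) (λ ()) ∘ ∈-tabulate

      co-independent : ∀ y z → y ∉ domSet → z ∉ domSet → Adj G y z → ⊥
      co-independent y z y∉ z∉ =
        outside-cover dom (cover-mono core⊆dom core-covers) (decode b d y) (decode b d z) (∉domSet y∉) (∉domSet z∉)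

  domSet-size : ∣ domSet ∣ ≡ n * 1 + (b * 2 + d * 2)
  domSet-size = trans (∣tabulate-decode∣ dom) (∑V-uniform centre domStar spiderCore)

  -- A total dominating set contains every hub vertex (it dominates the pendant
  -- leaves), and the centre and a further vertex of each star and each spider.
  dominating-bound : ∀ D → TotalDominating G D → n * 1 + (b * 2 + d * 2) ≤ ∣ D ∣
  dominating-bound D dominating = begin
    n * 1 + (b * 2 + d * 2) ≤⟨ ∑V-≥ (bit ∘ inD) hub-bound star-bound spider-bound ⟩
    ∑V (bit ∘ inD)          ≡⟨ sym (sum-vertices _) ⟩
    count (lookup D)        ≡⟨ sym (∣∣-count D) ⟩
    ∣ D ∣                    ∎
    where
      open Data.Nat.Properties.≤-Reasoning
      inD : Vtx b d → Bool
      inD w = lookup D (enc w)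

      dominator : ∀ w → Σ (Vtx b d) λ w' → T (inD w') × w ~ w'
      dominator w with dominating (enc w)
      ... | z , z∈ , a = decode b d z , subst (T ∘ lookup D) (sym (enc-dec z)) (∈⇒T z∈) , Adj⇒~ w z a

      hub-bound : ∀ x → 1 ≤ count (inD ∘ hub x)
      hub-bound x with dominator (pend x 0F)
      ... | w , w∈ , e = marked (inD ∘ hub x) {0F} (subst (T ∘ inD) (pend-nb {x} {0F} {w} e) w∈)

      star-bound : ∀ i → 2 ≤ count (inD ∘ starU i)
      star-bound i with dominator (starU i 2F) | dominator (starU i 0F)
      ... | w , w∈ , e | w' , w'∈ , e' with star-nb {i} {0F} {w'} (λ ()) e'
      ...   | l , refl , 0~l = marked₂ (inD ∘ starU i) (centre-≢ starE (λ ()) 0~l)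
                                 (subst (T ∘ inD) (star-leaf-centre {i} {w} 0F e) w∈) w'∈

      spider-bound : ∀ i → 2 ≤ count (inD ∘ spidV i)
      spider-bound i with dominator (spidV i 1F) | dominator (spidV i 0F)
      ... | w , w∈ , e | w' , w'∈ , e' with spider-nb {i} {0F} {w'} (λ ()) e'
      ...   | l , refl , 0~l = marked₂ (inD ∘ spidV i) (centre-≢ spidE (λ ()) 0~l)
                                 (subst (T ∘ inD) (spider-leaf-centre {i} {w} 1F (λ ()) tt e) w∈) w'∈

  independence-number : IsIndependenceNumber G (n * 2 + (b * 3 + d * 3))
  independence-number = (indepSet , indepSet-independent , indepSet-size) , independent-bound

  tcoi-number : (∀ x → Σ (Fin (b + d)) (Adj Tr x)) → Fin (b + d) → IsTCoiNumber G (n * 1 + (b * 2 + d * 2))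
  tcoi-number nb x₀ = (domSet , domSet-tcoi nb x₀ , domSet-size) , λ D tc → dominating-bound D (proj₁ tc)

+[m+k]-+m : ∀ m k → + (m + k) - + m ≡ + k
+[m+k]-+m m k = trans (m-n≡m⊖n (m + k) m) (trans (⊖-≥ (m≤m+n m k)) (cong +_ (m+n∸m≡n m k)))

order-formula : ∀ b d → (b + d) + ((b + d) * 2 + (b * 4 + d * 5)) ≡ 3 * (b + d) + 4 * b + 5 * d
order-formula = solve-∀

leaf-formula : ∀ b d → (b + d) * 2 + (b * 2 + d * 2) ≡ 2 * (b + d) + 2 * b + 2 * d
leaf-formula = solve-∀

β-formula : ∀ b d → (b + d) * 2 + (b * 3 + d * 3) ≡ 2 * (b + d) + 3 * b + 3 * d
β-formula = solve-∀

γ-formula : ∀ b d → (b + d) * 1 + (b * 2 + d * 2) ≡ (b + d) + 2 * b + 2 * d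
γ-formula = solve-∀

first-gap : ∀ b d →
  + ((b + d) + 2 * b + 2 * d) - (+ order b d - + (2 * (b + d) + 3 * b + 3 * d)) ≡ + b
first-gap b d = begin
  + γ - (+ order b d - + β)  ≡⟨ cong₂ (λ s t → + s - (+ t - + β)) (γ≡m+b b d) (order≡β+m b d) ⟩
  + (m + b) - (+ (β + m) - + β) ≡⟨ cong (λ t → + (m + b) - t) (+[m+k]-+m β m) ⟩
  + (m + b) - + m            ≡⟨ +[m+k]-+m m b ⟩
  + b                        ∎
  where
    open ≡-Reasoning
    γ = (b + d) + 2 * b + 2 * d
    β = 2 * (b + d) + 3 * b + 3 * d
    m = (b + d) + b + 2 * d
    γ≡m+b : ∀ b d → (b + d) + 2 * b + 2 * d ≡ ((b + d) + b + 2 * d) + b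
    γ≡m+b = solve-∀
    order≡β+m : ∀ b d → (b + d) + ((b + d) * 2 + (b * 4 + d * 5))
                      ≡ (2 * (b + d) + 3 * b + 3 * d) + ((b + d) + b + 2 * d)
    order≡β+m = solve-∀

second-gap : ∀ b d →
  (+ order b d - + (2 * (b + d) + 2 * b + 2 * d)) - + ((b + d) + 2 * b + 2 * d) ≡ + d
second-gap b d = begin
  (+ order b d - + ℓ) - + γ   ≡⟨ cong (λ t → (+ t - + ℓ) - + γ) (order≡ℓ+γ+d b d) ⟩
  (+ (ℓ + (γ + d)) - + ℓ) - + γ ≡⟨ cong (_- + γ) (+[m+k]-+m ℓ (γ + d)) ⟩
  + (γ + d) - + γ             ≡⟨ +[m+k]-+m γ d ⟩
  + d                         ∎
  where
    open ≡-Reasoning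
    γ = (b + d) + 2 * b + 2 * d
    ℓ = 2 * (b + d) + 2 * b + 2 * d
    order≡ℓ+γ+d : ∀ b d → (b + d) + ((b + d) * 2 + (b * 4 + d * 5))
                        ≡ (2 * (b + d) + 2 * b + 2 * d) + (((b + d) + 2 * b + 2 * d) + d)
    order≡ℓ+γ+d = solve-∀

mainTheorem8 : (b d : ℕ) → 1 ≤ b → 1 ≤ d →
    (T : Graph (b + d)) → IsTree T →
    (order b d ≡ 3 * (b + d) + 4 * b + 5 * d) ×
    (leafCount (Tbd b d T) ≡ 2 * (b + d) + 2 * b + 2 * d) ×
    IsIndependenceNumber (Tbd b d T) (2 * (b + d) + 3 * b + 3 * d) ×
    IsTCoiNumber (Tbd b d T) ((b + d) + 2 * b + 2 * d) ×
    (∀ γ β → IsTCoiNumber (Tbd b d T) γ → IsIndependenceNumber (Tbd b d T) β →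
    ((+ γ) - ((+ order b d) - (+ β)) ≡ + b) ×
    (((+ order b d) - (+ leafCount (Tbd b d T))) - (+ γ) ≡ + d))
mainTheorem8 b d (s≤s z≤n) (s≤s z≤n) Tr (_ , connected , _) =
  order-formula b d , leaves , β-number , γ-number , gaps
  where
    open Construction b d Tr

    neighbour : ∀ x → Σ (Fin (b + d)) (Adj Tr x)
    neighbour = connected⇒neighbour Tr connected {zero} {b ↑ʳ zero} (λ ())

    leaves : leafCount (Tbd b d Tr) ≡ 2 * (b + d) + 2 * b + 2 * d
    leaves = trans leafCount-Tbd (leaf-formula b d)

    β-number : IsIndependenceNumber (Tbd b d Tr) (2 * (b + d) + 3 * b + 3 * d)
    β-number = subst (IsIndependenceNumber G) (β-formula b d) independence-number

    γ-number : IsTCoiNumber (Tbd b d Tr) ((b + d) + 2 * b + 2 * d)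
    γ-number = subst (IsTCoiNumber G) (γ-formula b d) (tcoi-number neighbour zero)

    gaps : ∀ γ β → IsTCoiNumber G γ → IsIndependenceNumber G β →
           ((+ γ) - ((+ order b d) - (+ β)) ≡ + b) ×
           (((+ order b d) - (+ leafCount G)) - (+ γ) ≡ + d)
    gaps γ β γ-num β-num =
      subst₂ (λ γ β → + γ - (+ order b d - + β) ≡ + b) (sym γ≡) (sym β≡) (first-gap b d) ,
      subst₂ (λ ℓ γ → (+ order b d - + ℓ) - + γ ≡ + d) (sym leaves) (sym γ≡) (second-gap b d)
      where
        γ≡ : γ ≡ (b + d) + 2 * b + 2 * d
        γ≡ = tcoi-number-unique G γ-num γ-number
        β≡ : β ≡ 2 * (b + d) + 3 * b + 3 * d
        β≡ = independence-number-unique G β-num β-number
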